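{- Let $D$ be a finite simple digraph and let $S$ be a spanning subdigraph of $\mathcal{W}(D)$. Then $S$ is Eulerian if and only if both of the following hold: (1) the arc set of $S$ is a (possibly empty) union of pairwise edge-disjoint $\gamma$-paths; (2) for each $v\in V(D)$, $d^+_S(v^*)=d^-_S(v^*)$.
   Context: A digraph is Eulerian if every vertex has equal in- and out-degree (connectivity not required); a spanning subdigraph has the same vertex set. For a digraph $D$, $N_D(v)$ is the set of vertices joined to $v$ by an arc in either direction, $N_D[v]=N_D(v)\cup\{v\}$, $U\triangle V=(U\setminus V)\cup(V\setminus U)$. The digraph $\mathcal{W}(D)$: for each arc $vw$ of $D$ create new vertices $x^{vw}$ for every $x\in N_D(v)\triangle N_D(w)$ and $y^{vw}_x$ for every $x\in N_D(w)\setminus N_D[v]$, with arcs $v^{vw}\to x^{vw}$ for $x\in N_D(v)\setminus N_D(w)$ and arcs $v^{vw}\to y^{vw}_x$, $y^{vw}_x\to x^{vw}$ for $x\in N_D(w)\setminus N_D[v]$ (sectors for distinct arcs are vertex-disjoint). Additionally add a vertex $x^*$ for each $x\in V(D)$, an arc $v^*\to v^{vw}$ for each arc $vw$ of $D$, and an arc $x^{vw}\to x^*$ for each vertex $x^{vw}$ with $x\neq v$. $\gamma$-paths: for an arc $vw$ of $D$ and $x\in N_D[v]\triangle N_D(w)$, the directed path ${}_{v^*}P^{vw}_{x^*}$ is $v^*\to v^{vw}\to x^{vw}\to x^*$ if $x\in N_D[v]\setminus N_D(w)$, and $v^*\to v^{vw}\to y^{vw}_x\to x^{vw}\to x^*$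 if $x\in N_D(w)\setminus N_D[v]$. -}

module Defs where

open import Data.Nat using (ℕ; zero; suc; _+_)
open import Data.Bool using (Bool; true; false; _∧_; _∨_; not; _xor_; if_then_else_; T)
open import Data.Fin using (Fin)
open import Data.Fin using () renaming (_≟_ to _≟F_)
open import Data.List using (List; []; _∷_; _++_; map; concatMap)
open import Data.Nat.ListAction using (sum)
open import Data.List.Membership.Propositional using (_∈_)
open import Data.List.Relation.Unary.All using (All)
open import Data.List.Relation.Unary.Any using (Any)
open import Data.List.Relation.Unary.AllPairs using (AllPairs)
open import Data.Product using (Σ; _×_; _,_; ∃)
open import Data.Empty using (⊥)
open import Relation.Nullary.Decidable using (⌊_⌋)
open import Relation.Binary.PropositionalEquality using (_≡_)
open import Function.Bundles using (_⇔_)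

allFin : (n : ℕ) → List (Fin n)
allFin n = Data.List.allFin n

record SimpleDigraph (n : ℕ) : Set where
  field
    arc      : Fin n → Fin n → Bool
    loopless : ∀ v → arc v v ≡ false
open SimpleDigraph public

Arc : ∀ {n} → SimpleDigraph n → Fin n → Fin n → Set
Arc D v w = T (arc D v w)

_==_ : ∀ {n} → Fin n → Fin n → Bool
x == y = ⌊ x ≟F y ⌋

module _ {n : ℕ} (D : SimpleDigraph n) where

  inN : Fin n → Fin n → Bool
  inN v x = arc D v x ∨ arc D x v

  inNc : Fin n → Fin n → Bool
  inNc v x = inN v x ∨ (x == v)

  -- The digraph W(D).
  -- star x       is x^*
  -- sec v w x    is x^{vw}
  -- ysec v w x   is y^{vw}_x
  data WV : Set where
    star : Fin n → WV
    sec  : Fin n → Fin n → Fin n → WV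
    ysec : Fin n → Fin n → Fin n → WV

  symN : Fin n → Fin n → Fin n → Bool
  symN v w x = inN v x xor inN w x

  NvMinusNw : Fin n → Fin n → Fin n → Bool
  NvMinusNw v w x = inN v x ∧ not (inN w x)

  NwMinusNcv : Fin n → Fin n → Fin n → Bool
  NwMinusNcv v w x = inN w x ∧ not (inNc v x)

  NcvMinusNw : Fin n → Fin n → Fin n → Bool
  NcvMinusNw v w x = inNc v x ∧ not (inN w x)

  isVertex : WV → Bool
  isVertex (star x)     = true
  isVertex (sec v w x)  = arc D v w ∧ symN v w x
  isVertex (ysec v w x) = arc D v w ∧ NwMinusNcv v w x

  warc : WV → WV → Bool
  warc (sec v w u) (sec v' w' x) =
    arc D v w ∧ (v' == v) ∧ (w' == w) ∧ (u == v) ∧ NvMinusNw v w x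
  warc (sec v w u) (ysec v' w' x) =
    arc D v w ∧ (v' == v) ∧ (w' == w) ∧ (u == v) ∧ NwMinusNcv v w x
  warc (ysec v w x) (sec v' w' x') =
    arc D v w ∧ (v' == v) ∧ (w' == w) ∧ (x' == x) ∧ NwMinusNcv v w x
  warc (sec v w x) (star x') =
    arc D v w ∧ symN v w x ∧ not (x == v) ∧ (x' == x)
  warc (star v') (sec v w u) =
    arc D v w ∧ (v' == v) ∧ (u == v)
  warc _ _ = false

  allWV : List WV
  allWV = map star (allFin n) ++
          concatMap (λ v → concatMap (λ w → concatMap
            (λ x → sec v w x ∷ ysec v w x ∷ []) (allFin n)) (allFin n)) (allFin n)

  record SpanningSub : Set where
    field
      sarc   : WV → WV → Bool
      sarc⊆  : ∀ a b → T (sarc a b) → T (warc a b)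
  open SpanningSub public

  b2n : Bool → ℕ
  b2n true  = 1
  b2n false = 0

  outdeg : SpanningSub → WV → ℕ
  outdeg S a = sum (map (λ b → b2n (sarc S a b)) allWV)

  indeg : SpanningSub → WV → ℕ
  indeg S a = sum (map (λ b → b2n (sarc S b a)) allWV)

  Eulerian : SpanningSub → Set
  Eulerian S = ∀ a → T (isVertex a) → outdeg S a ≡ indeg S a

  -- γ-paths, given as their lists of arcs.
  -- A γ-path is indexed by (v , w , x) with vw an arc of D and
  -- x ∈ N[v] △ N(w).

  WArcE : Set
  WArcE = WV × WV

  IsGammaIndex : Fin n × Fin n × Fin n → Set
  IsGammaIndex (v , w , x) = T (arc D v w) × T (inNc v x xor inN w x)

  gammaPath : Fin n × Fin n × Fin n → List WArcE
  gammaPath (v , w , x) =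
    if NcvMinusNw v w x
    then (star v , sec v w v) ∷ (sec v w v , sec v w x) ∷ (sec v w x , star x) ∷ []
    else (star v , sec v w v) ∷ (sec v w v , ysec v w x) ∷
         (ysec v w x , sec v w x) ∷ (sec v w x , star x) ∷ []

  ArcDisjoint : List WArcE → List WArcE → Set
  ArcDisjoint P Q = ∀ e → e ∈ P → e ∈ Q → ⊥

  UnionOfDisjointGammaPaths : SpanningSub → Set
  UnionOfDisjointGammaPaths S =
    Σ (List (Fin n × Fin n × Fin n)) λ ps →
        All IsGammaIndex ps
      × AllPairs (λ p q → ArcDisjoint (gammaPath p) (gammaPath q)) ps
      × (∀ a b → T (sarc S a b) ⇔ Any (λ p → (a , b) ∈ gammaPath p) ps)

  StarsBalanced : SpanningSub → Set
  StarsBalanced S = ∀ v → outdeg S (star v) ≡ indeg S (star v)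

-- In W(D) every vertex other than the stars has exactly one in-neighbour, and every
-- sector vertex other than the root v^{vw} has exactly one out-neighbour.  So the
-- sector of an arc vw is an out-tree hanging from v^* through the root, and its
-- branches into the stars are exactly the γ-paths of vw; in particular all γ-paths of
-- one sector share the arc v^* → v^{vw}.
--
-- If S is Eulerian, the root has in-degree, hence out-degree, at most one in S, so S
-- follows at most one branch per sector, and flow conservation at the sector vertices
-- propagates each used arc along its whole branch: S is the union of the γ-paths of
-- the branches it uses, and these are arc-disjoint because they lie in distinct
-- sectors.  Conversely, arc-disjoint γ-paths meet every sector in at most one path, so
-- at each sector vertex S has in- and out-degree both 0, or both 1 (a simple path
-- passes through it); condition (2) takes care of the stars.

module Submission where

open import Defs
open import Data.Bool using (Bool; true; false; T; not; _∧_; _∨_; _xor_; if_then_else_)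
open import Data.Bool.Properties using (T-∧)
open import Data.Empty using (⊥; ⊥-elim)
open import Data.Fin using (Fin) renaming (_≟_ to _≟F_)
open import Data.List using (List; []; _∷_; map; concatMap; filter; cartesianProduct)
open import Data.List.Membership.Propositional using (_∈_; find; lose)
open import Data.List.Membership.Propositional.Properties
  using (∈-allFin; ∈-map⁺; ∈-map⁻; ∈-++⁺ˡ; ∈-++⁺ʳ; ∈-concat⁺′; ∈-concatMap⁻;
         ∈-cartesianProduct⁺; ∈-filter⁺; ∈-filter⁻)
open import Data.List.Properties using (map-cong)
open import Data.List.Relation.Unary.All as All using (All; []; _∷_)
import Data.List.Relation.Unary.All.Properties as Allₚ
open import Data.List.Relation.Unary.AllPairs as AllPairs using (AllPairs; []; _∷_)
import Data.List.Relation.Unary.AllPairs.Properties as AllPairsₚ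
open import Data.List.Relation.Unary.Any as Any using (Any; here; there)
open import Data.List.Relation.Unary.Unique.Propositional using (Unique)
import Data.List.Relation.Unary.Unique.Propositional.Properties as Unique
open import Data.Maybe using (Maybe; just; nothing; _<∣>_)
open import Data.Nat using (ℕ; suc; _≤_; z≤n; s≤s)
open import Data.Nat.ListAction using (sum)
open import Data.Nat.Properties using (≤-trans; ≤-antisym; ≤-reflexive; m≤n+m; 1+n≰n)
open import Data.Product using (∃; _×_; _,_; proj₁; proj₂)
open import Data.Sum using (_⊎_; inj₁; inj₂)
open import Function using (_∘_)
open import Function.Bundles using (_⇔_; mk⇔; Equivalence)
open import Relation.Nullary using (¬_; yes; no)
open import Relation.Unary using (Decidable)
open import Relation.Nullary.Decidable using (T?; _⊎-dec_; fromWitness)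
open import Relation.Binary.PropositionalEquality
  using (_≡_; _≢_; refl; sym; trans; cong; subst; module ≡-Reasoning)

private variable
  A B : Set
  p q : Bool

∧⁺ : T p → T q → T (p ∧ q)
∧⁺ tp tq = Equivalence.from T-∧ (tp , tq)

∧-not⇒xor : ∀ p q → T (p ∧ not q) → T (p xor q)
∧-not⇒xor true  false _ = _
∧-not⇒xor true  true  ()
∧-not⇒xor false _     ()

not-∧⇒xor : ∀ p q → T (q ∧ not p) → T (p xor q)
not-∧⇒xor false true  _ = _
not-∧⇒xor true  true  ()
not-∧⇒xor _     false ()

count : (A → Bool) → List A → ℕ
count f xs = sum (map (λ x → if f x then 1 else 0) xs)

AtMostOne : (A → Bool) → Set
AtMostOne f = ∀ {x y} → T (f x) → T (f y) → x ≡ y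

count≡0 : ∀ (f : A → Bool) {xs} → All (λ x → ¬ T (f x)) xs → count f xs ≡ 0
count≡0 f [] = refl
count≡0 f (_∷_ {x} ¬fx ¬fxs) with f x
... | true  = ⊥-elim (¬fx _)
... | false = count≡0 f ¬fxs

count-pos : ∀ (f : A → Bool) {x xs} → x ∈ xs → T (f x) → 1 ≤ count f xs
count-pos f {x} (here refl) fx with f x
... | true = s≤s z≤n
count-pos f (there x∈) fx = ≤-trans (count-pos f x∈ fx) (m≤n+m _ _)

count-pos⇒∃ : ∀ (f : A → Bool) xs → 1 ≤ count f xs → ∃ λ x → T (f x)
count-pos⇒∃ f (x ∷ xs) pos with f x in fx≡true
... | true  = x , subst T (sym fx≡true) _
... | false = count-pos⇒∃ f xs pos

count≤1 : ∀ (f : A → Bool) {xs} → Unique xs → AtMostOne f → count f xs ≤ 1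
count≤1 f [] _ = z≤n
count≤1 f (_∷_ {x} x∉ u) atMostOne with f x in fx≡true
... | true  = ≤-reflexive (cong suc (count≡0 f (All.map others-fail x∉)))
  where
  others-fail : ∀ {y} → x ≢ y → ¬ T (f y)
  others-fail x≢y fy = x≢y (atMostOne (subst T (sym fx≡true) _) fy)
... | false = count≤1 f u atMostOne

count≤1⇒≡ : ∀ (f : A → Bool) {xs x y} → count f xs ≤ 1 →
            x ∈ xs → y ∈ xs → T (f x) → T (f y) → x ≡ y
count≤1⇒≡ f _  (here refl) (here refl) _  _  = refl
count≤1⇒≡ f {x ∷ xs} ≤1 (here refl) (there y∈) fx fy =
  ⊥-elim (1+n≰n (≤-trans (two fx (count-pos f y∈ fy)) ≤1))
  where
  two : T (f x) → 1 ≤ count f xs → 2 ≤ count f (x ∷ xs)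
  two fx pos with f x
  ... | true = s≤s pos
count≤1⇒≡ f ≤1 (there x∈)  (here refl) fx fy = sym (count≤1⇒≡ f ≤1 (here refl) (there x∈) fy fx)
count≤1⇒≡ f ≤1 (there x∈)  (there y∈)  fx fy = count≤1⇒≡ f (≤-trans (m≤n+m _ _) ≤1) x∈ y∈ fx fy

count-mono : ∀ (f g : A → Bool) {xs} → Unique xs → (∀ x → x ∈ xs) → AtMostOne f →
             (∃ (T ∘ f) → ∃ (T ∘ g)) → count f xs ≤ count g xs
count-mono f g {xs} u complete atMostOne f⇒g = bounded (count≤1 f u atMostOne) λ pos →
  let (x , gx) = f⇒g (count-pos⇒∃ f xs pos) in count-pos g (complete x) gx
  where
  bounded : ∀ {m k} → m ≤ 1 → (1 ≤ m → 1 ≤ k) → m ≤ k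
  bounded z≤n       _   = z≤n
  bounded (s≤s z≤n) pos = pos (s≤s z≤n)

count-cong : ∀ (f g : A → Bool) {xs} → Unique xs → (∀ x → x ∈ xs) →
             AtMostOne f → AtMostOne g →
             (∃ (T ∘ f) → ∃ (T ∘ g)) → (∃ (T ∘ g) → ∃ (T ∘ f)) → count f xs ≡ count g xs
count-cong f g u complete f≤1 g≤1 f⇒g g⇒f =
  ≤-antisym (count-mono f g u complete f≤1 f⇒g) (count-mono g f u complete g≤1 g⇒f)

∈-concatMap⁺′ : ∀ {f : A → List B} {x y xs} → y ∈ f x → x ∈ xs → y ∈ concatMap f xs
∈-concatMap⁺′ {f = f} y∈ x∈ = ∈-concat⁺′ y∈ (∈-map⁺ f x∈)

Unique-concatMap : ∀ (f : A → List B) {xs} → (∀ {x y b} → b ∈ f x → b ∈ f y → x ≡ y) →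
                   Unique xs → (∀ x → Unique (f x)) → Unique (concatMap f xs)
Unique-concatMap f separated u uf =
  Unique.concat⁺ (Allₚ.map⁺ (All.universal uf _))
                 (AllPairsₚ.map⁺ (AllPairs.map (λ x≢y {_} (b∈fx , b∈fy) → x≢y (separated b∈fx b∈fy)) u))

Unique⇒AllPairs : ∀ {P : A → Set} {R : A → A → Set} {xs} → Unique xs → All P xs →
                  (∀ {x y} → P x → P y → x ≢ y → R x y) → AllPairs R xs
Unique⇒AllPairs []        []         _ = []
Unique⇒AllPairs (x∉ ∷ u) (px ∷ pxs) r =
  All.zipWith (λ (x≢y , py) → r px py x≢y) (x∉ , pxs) ∷ Unique⇒AllPairs u pxs r

pairwiseDisjoint-shared⇒≡ : ∀ (f : A → List B) {xs x y e} →
  AllPairs (λ p q → ∀ e → e ∈ f p → e ∈ f q → ⊥) xs →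
  x ∈ xs → y ∈ xs → e ∈ f x → e ∈ f y → x ≡ y
pairwiseDisjoint-shared⇒≡ f _        (here refl) (here refl) _  _  = refl
pairwiseDisjoint-shared⇒≡ f (d ∷ _)  (here refl) (there y∈)  ex ey = ⊥-elim (All.lookup d y∈ _ ex ey)
pairwiseDisjoint-shared⇒≡ f (d ∷ _)  (there x∈)  (here refl) ex ey = ⊥-elim (All.lookup d x∈ _ ey ex)
pairwiseDisjoint-shared⇒≡ f (_ ∷ ds) (there x∈)  (there y∈)  ex ey =
  pairwiseDisjoint-shared⇒≡ f ds x∈ y∈ ex ey

-- Paths given by their vertex sequences

pathArcs : List A → List (A × A)
pathArcs (x ∷ y ∷ xs) = (x , y) ∷ pathArcs (y ∷ xs)
pathArcs _            = []

pathArcs-source∈ : ∀ {x y : A} {xs} → (x , y) ∈ pathArcs xs → x ∈ xs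
pathArcs-source∈ {xs = _ ∷ _ ∷ _} (here refl) = here refl
pathArcs-source∈ {xs = _ ∷ _ ∷ _} (there m)   = there (pathArcs-source∈ m)

pathArcs-target∈ : ∀ {x y z : A} {xs} → (x , y) ∈ pathArcs (z ∷ xs) → y ∈ xs
pathArcs-target∈ {xs = _ ∷ _} (here refl) = here refl
pathArcs-target∈ {xs = _ ∷ _} (there m)   = there (pathArcs-target∈ m)

pathArcs-succ-unique : ∀ {x y z : A} {xs} → Unique xs →
                       (x , y) ∈ pathArcs xs → (x , z) ∈ pathArcs xs → y ≡ z
pathArcs-succ-unique {xs = _ ∷ _ ∷ _} _        (here refl) (here refl) = refl
pathArcs-succ-unique {xs = _ ∷ _ ∷ _} (x∉ ∷ _) (here refl) (there m)   =
  ⊥-elim (All.lookup x∉ (pathArcs-source∈ m) refl)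
pathArcs-succ-unique {xs = _ ∷ _ ∷ _} (x∉ ∷ _) (there m)   (here refl) =
  ⊥-elim (All.lookup x∉ (pathArcs-source∈ m) refl)
pathArcs-succ-unique {xs = _ ∷ _ ∷ _} (_ ∷ u)  (there m)   (there m′)  = pathArcs-succ-unique u m m′

pathArcs-pred-unique : ∀ {x y z : A} {xs} → Unique xs →
                       (x , z) ∈ pathArcs xs → (y , z) ∈ pathArcs xs → x ≡ y
pathArcs-pred-unique {xs = _ ∷ _ ∷ _} _            (here refl) (here refl) = refl
pathArcs-pred-unique {xs = _ ∷ _ ∷ _} (_ ∷ z∉ ∷ _) (here refl) (there m)   =
  ⊥-elim (All.lookup z∉ (pathArcs-target∈ m) refl)
pathArcs-pred-unique {xs = _ ∷ _ ∷ _} (_ ∷ z∉ ∷ _) (there m)   (here refl) =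
  ⊥-elim (All.lookup z∉ (pathArcs-target∈ m) refl)
pathArcs-pred-unique {xs = _ ∷ _ ∷ _} (_ ∷ u)      (there m)   (there m′)  = pathArcs-pred-unique u m m′

-- The digraph W(D)

module _ {n : ℕ} (D : SimpleDigraph n) where

  private variable
    v w x x′ : Fin n
    a b c : WV D
    vw : Fin n × Fin n

  root : Fin n → Fin n → WV D
  root v w = sec v w v

  copyOf : WV D → Fin n
  copyOf (star x)     = x
  copyOf (sec _ _ x)  = x
  copyOf (ysec _ _ x) = x

  sector : WV D → Maybe (Fin n × Fin n)
  sector (star _)     = nothing
  sector (sec v w _)  = just (v , w)
  sector (ysec v w _) = just (v , w)

  arcSector : WArcE D → Maybe (Fin n × Fin n)
  arcSector (a , b) = sector a <∣> sector b

  arcSector-source : sector a ≡ just vw → arcSector (a , b) ≡ just vw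
  arcSector-source sa rewrite sa = refl

  ==-refl : ∀ (x : Fin n) → T (x == x)
  ==-refl x = fromWitness refl

  NvMinusNw⇒NcvMinusNw : T (NvMinusNw D v w x) → T (NcvMinusNw D v w x)
  NvMinusNw⇒NcvMinusNw {v} {w} {x} = table (inN D v x) (inN D w x) (x == v)
    where
    table : ∀ a b c → T (a ∧ not b) → T ((a ∨ c) ∧ not b)
    table true  false _ _ = _
    table true  true  _ ()
    table false _     _ ()

  NwMinusNcv⇒¬NcvMinusNw : T (NwMinusNcv D v w x) → ¬ T (NcvMinusNw D v w x)
  NwMinusNcv⇒¬NcvMinusNw {v} {w} {x} = table (inN D v x) (inN D w x) (x == v)
    where
    table : ∀ a b c → T (b ∧ not (a ∨ c)) → ¬ T ((a ∨ c) ∧ not b)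
    table false true  false _ ()
    table false true  true  ()
    table true  true  _     ()
    table _     false _     ()

  NvMinusNw⇒symN : T (NvMinusNw D v w x) → T (symN D v w x)
  NvMinusNw⇒symN {v} {w} {x} = ∧-not⇒xor (inN D v x) (inN D w x)

  NwMinusNcv⇒symN : T (NwMinusNcv D v w x) → T (symN D v w x)
  NwMinusNcv⇒symN {v} {w} {x} = table (inN D v x) (inN D w x) (x == v)
    where
    table : ∀ a b c → T (b ∧ not (a ∨ c)) → T (a xor b)
    table false true  false _ = _
    table false true  true  ()
    table true  true  _     ()
    table _     false _     ()

  NvMinusNw⇒γ : T (NvMinusNw D v w x) → T (inNc D v x xor inN D w x)
  NvMinusNw⇒γ {v} {w} {x} = ∧-not⇒xor (inNc D v x) (inN D w x) ∘ NvMinusNw⇒NcvMinusNw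

  NwMinusNcv⇒γ : T (NwMinusNcv D v w x) → T (inNc D v x xor inN D w x)
  NwMinusNcv⇒γ {v} {w} {x} = not-∧⇒xor (inNc D v x) (inN D w x)

  NvMinusNw⇒≢ : T (NvMinusNw D v w x) → x ≢ v
  NvMinusNw⇒≢ {v} {w} t refl = table (arc D v v) (not (inN D w v)) (loopless D v) t
    where
    table : ∀ a b → a ≡ false → ¬ T ((a ∨ a) ∧ b)
    table false _ _ ()

  NwMinusNcv⇒≢ : T (NwMinusNcv D v w x) → x ≢ v
  NwMinusNcv⇒≢ {v} {w} t refl = table (inN D v v) (inN D w v) (v == v) (==-refl v) t
    where
    table : ∀ a b c → T c → ¬ T (b ∧ not (a ∨ c))
    table _     _     false ()
    table _     false true  _ ()
    table true  true  true  _ ()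
    table false true  true  _ ()

  γ⇒≢ : IsGammaIndex D (v , w , x) → x ≢ v
  γ⇒≢ {v} {w} (ta , tγ) refl = table (inN D v v) (v == v) (arc D w v) (arc D v w) (==-refl v) ta tγ
    where
    table : ∀ a b c d → T b → T d → ¬ T ((a ∨ b) xor (c ∨ d))
    table _     false _     _     ()
    table _     true  _     false _ ()
    table true  true  true  true  _ _ ()
    table true  true  false true  _ _ ()
    table false true  true  true  _ _ ()
    table false true  false true  _ _ ()

  root-symN : T (arc D v w) → T (symN D v w v)
  root-symN {v} {w} = table (arc D v v) (arc D w v) (arc D v w) (loopless D v)
    where
    table : ∀ a b c → a ≡ false → T c → T ((a ∨ a) xor (b ∨ c))
    table false true  true  _ _ = _
    table false false true  _ _ = _
    table false _     false _ ()
    table true  _     _     ()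

  data WArc : WV D → WV D → Set where
    enter  : T (arc D v w) → WArc (star v) (root v w)
    direct : T (arc D v w) → T (NvMinusNw D v w x) → WArc (root v w) (sec v w x)
    detour : T (arc D v w) → T (NwMinusNcv D v w x) → WArc (root v w) (ysec v w x)
    rejoin : T (arc D v w) → T (NwMinusNcv D v w x) → WArc (ysec v w x) (sec v w x)
    leave  : T (arc D v w) → T (symN D v w x) → x ≢ v → WArc (sec v w x) (star x)

  private
    decodeEnter : ∀ {v′ v w u u′ : Fin n} → T (arc D v w ∧ (v′ == v) ∧ (u == u′)) →
                  T (arc D v w) × v′ ≡ v × u ≡ u′
    decodeEnter {v′} {v} {w} {u} {u′} t with arc D v w | v′ ≟F v | u ≟F u′
    ... | true  | yes e₁ | yes e₂ = _ , e₁ , e₂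
    ... | true  | yes _  | no _   = ⊥-elim t
    ... | true  | no _   | _      = ⊥-elim t
    ... | false | _      | _      = ⊥-elim t

    decodeSector : ∀ {v′ v w′ w u u′ : Fin n} →
                   T (arc D v w ∧ (v′ == v) ∧ (w′ == w) ∧ (u == u′) ∧ q) →
                   T (arc D v w) × v′ ≡ v × w′ ≡ w × u ≡ u′ × T q
    decodeSector {v′ = v′} {v} {w′} {w} {u} {u′} t
      with arc D v w | v′ ≟F v | w′ ≟F w | u ≟F u′
    ... | true  | yes e₁ | yes e₂ | yes e₃ = _ , e₁ , e₂ , e₃ , t
    ... | true  | yes _  | yes _  | no _   = ⊥-elim t
    ... | true  | yes _  | no _   | _      = ⊥-elim t
    ... | true  | no _   | _      | _      = ⊥-elim t
    ... | false | _      | _      | _      = ⊥-elim t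

    decodeLeave : ∀ {v w x x′ : Fin n} → T (arc D v w ∧ q ∧ not (x == v) ∧ (x′ == x)) →
                  T (arc D v w) × T q × x ≢ v × x′ ≡ x
    decodeLeave {q = q} {v} {w} {x} {x′} t with arc D v w | q | x ≟F v | x′ ≟F x
    ... | true  | true  | no x≢v | yes e = _ , _ , x≢v , e
    ... | true  | true  | no _   | no _  = ⊥-elim t
    ... | true  | true  | yes _  | _     = ⊥-elim t
    ... | true  | false | _      | _     = ⊥-elim t
    ... | false | _     | _      | _     = ⊥-elim t

  warc⇒WArc : ∀ a b → T (warc D a b) → WArc a b
  warc⇒WArc (sec v w u) (sec v′ w′ x) t with decodeSector {v′ = v′} {v} {w′} {w} {u} {v} t
  ... | ta , refl , refl , refl , tx = direct ta tx
  warc⇒WArc (sec v w u) (ysec v′ w′ x) t with decodeSector {v′ = v′} {v} {w′} {w} {u} {v} t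
  ... | ta , refl , refl , refl , tx = detour ta tx
  warc⇒WArc (ysec v w x) (sec v′ w′ x′) t with decodeSector {v′ = v′} {v} {w′} {w} {x′} {x} t
  ... | ta , refl , refl , refl , tx = rejoin ta tx
  warc⇒WArc (sec v w x) (star x′) t with decodeLeave {symN D v w x} {v} {w} {x} {x′} t
  ... | ta , ts , x≢v , refl = leave ta ts x≢v
  warc⇒WArc (star v′) (sec v w u) t with decodeEnter {v′ = v′} {v} {w} {u} {v} t
  ... | ta , refl , refl = enter ta

  WArc-source-isVertex : WArc a b → T (isVertex D a)
  WArc-source-isVertex (enter _)      = _
  WArc-source-isVertex (direct ta _)  = ∧⁺ ta (root-symN ta)
  WArc-source-isVertex (detour ta _)  = ∧⁺ ta (root-symN ta)
  WArc-source-isVertex (rejoin ta tn) = ∧⁺ ta tn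
  WArc-source-isVertex (leave ta ts _) = ∧⁺ ta ts

  WArc-target-isVertex : WArc a b → T (isVertex D b)
  WArc-target-isVertex (enter ta)     = ∧⁺ ta (root-symN ta)
  WArc-target-isVertex (direct ta tx) = ∧⁺ ta (NvMinusNw⇒symN tx)
  WArc-target-isVertex (detour ta tn) = ∧⁺ ta tn
  WArc-target-isVertex (rejoin ta tn) = ∧⁺ ta (NwMinusNcv⇒symN tn)
  WArc-target-isVertex (leave _ _ _)  = _

  WArc-into-root : WArc a (root v w) → a ≡ star v
  WArc-into-root (enter _)     = refl
  WArc-into-root (direct _ tx) = ⊥-elim (NvMinusNw⇒≢ tx refl)
  WArc-into-root (rejoin _ tn) = ⊥-elim (NwMinusNcv⇒≢ tn refl)

  WArc-into-ysec : WArc a (ysec v w x) → a ≡ root v w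
  WArc-into-ysec (detour _ _) = refl

  WArc-from-ysec : WArc (ysec v w x) b → b ≡ sec v w x
  WArc-from-ysec (rejoin _ _) = refl

  WArc-from-sec : x ≢ v → WArc (sec v w x) b → b ≡ star x
  WArc-from-sec x≢v (direct _ _)  = ⊥-elim (x≢v refl)
  WArc-from-sec x≢v (detour _ _)  = ⊥-elim (x≢v refl)
  WArc-from-sec x≢v (leave _ _ _) = refl

  sectorVertices : Fin n → Fin n → List (WV D)
  sectorVertices v w = concatMap (λ x → sec v w x ∷ ysec v w x ∷ []) (allFin n)

  sector-coords : ∀ {v′ w′} → sector a ≡ just (v , w) → sector a ≡ just (v′ , w′) → v ≡ v′ × w ≡ w′
  sector-coords e e′ with trans (sym e) e′
  ... | refl = refl , refl

  ∈sectorVertices⇒sector : a ∈ sectorVertices v w → sector a ≡ just (v , w)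
  ∈sectorVertices⇒sector {v = v} {w} m
    with Any.satisfied (∈-concatMap⁻ (λ x → sec v w x ∷ ysec v w x ∷ []) {allFin n} m)
  ... | _ , here refl         = refl
  ... | _ , there (here refl) = refl

  ∈sectorsOf⇒sector : a ∈ concatMap (sectorVertices v) (allFin n) → ∃ λ w → sector a ≡ just (v , w)
  ∈sectorsOf⇒sector {v = v} m with Any.satisfied (∈-concatMap⁻ (sectorVertices v) {allFin n} m)
  ... | w , m′ = w , ∈sectorVertices⇒sector m′

  sectorVertices-unique : ∀ v w → Unique (sectorVertices v w)
  sectorVertices-unique v w =
    Unique-concatMap (λ x → sec v w x ∷ ysec v w x ∷ []) {allFin n}
      (λ m m′ → trans (sym (copy m)) (copy m′)) (Unique.allFin⁺ n)
      (λ _ → ((λ ()) ∷ []) ∷ [] ∷ [])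
    where
    copy : a ∈ sec v w x ∷ ysec v w x ∷ [] → copyOf a ≡ x
    copy (here refl)         = refl
    copy (there (here refl)) = refl

  allWV-unique : Unique (allWV D)
  allWV-unique =
    Unique.++⁺ (Unique.map⁺ (λ { refl → refl }) (Unique.allFin⁺ n)) nonStars-unique stars-apart
    where
    nonStars : List (WV D)
    nonStars = concatMap (λ v → concatMap (sectorVertices v) (allFin n)) (allFin n)

    nonStars-unique : Unique nonStars
    nonStars-unique =
      Unique-concatMap (λ v → concatMap (sectorVertices v) (allFin n)) {allFin n}
        (λ m m′ → proj₁ (sector-coords (proj₂ (∈sectorsOf⇒sector m)) (proj₂ (∈sectorsOf⇒sector m′))))
        (Unique.allFin⁺ n)
        λ v → Unique-concatMap (sectorVertices v) {allFin n}
                (λ m m′ → proj₂ (sector-coords (∈sectorVertices⇒sector m) (∈sectorVertices⇒sector m′)))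
                (Unique.allFin⁺ n) (sectorVertices-unique v)

    stars-apart : ∀ {a} → ¬ (a ∈ map star (allFin n) × a ∈ nonStars)
    stars-apart (m , m′)
      with ∈-map⁻ star m | Any.satisfied (∈-concatMap⁻ (λ v → concatMap (sectorVertices v) (allFin n)) {allFin n} m′)
    ... | _ , _ , refl | _ , m″ with ∈sectorsOf⇒sector m″
    ...   | _ , ()

  allWV-complete : ∀ a → a ∈ allWV D
  allWV-complete (star x)     = ∈-++⁺ˡ (∈-map⁺ star (∈-allFin x))
  allWV-complete (sec v w x)  = ∈-++⁺ʳ (map star (allFin n))
    (∈-concatMap⁺′ (∈-concatMap⁺′ (∈-concatMap⁺′ (here refl) (∈-allFin x)) (∈-allFin w)) (∈-allFin v))
  allWV-complete (ysec v w x) = ∈-++⁺ʳ (map star (allFin n))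
    (∈-concatMap⁺′ (∈-concatMap⁺′ (∈-concatMap⁺′ (there (here refl)) (∈-allFin x)) (∈-allFin w)) (∈-allFin v))

  allTriples : List (Fin n × Fin n × Fin n)
  allTriples = cartesianProduct (allFin n) (cartesianProduct (allFin n) (allFin n))

  allTriples-complete : ∀ t → t ∈ allTriples
  allTriples-complete (v , w , x) =
    ∈-cartesianProduct⁺ (∈-allFin v) (∈-cartesianProduct⁺ (∈-allFin w) (∈-allFin x))

  allTriples-unique : Unique allTriples
  allTriples-unique = Unique.cartesianProduct⁺ (Unique.allFin⁺ n)
                        (Unique.cartesianProduct⁺ (Unique.allFin⁺ n) (Unique.allFin⁺ n))

  private
    b2n-if : ∀ t → b2n D t ≡ (if t then 1 else 0)
    b2n-if true  = refl
    b2n-if false = refl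

  outdeg-count : ∀ S a → outdeg D S a ≡ count (sarc S a) (allWV D)
  outdeg-count S a = cong sum (map-cong (b2n-if ∘ sarc S a) (allWV D))

  indeg-count : ∀ S a → indeg D S a ≡ count (λ b → sarc S b a) (allWV D)
  indeg-count S a = cong sum (map-cong (λ b → b2n-if (sarc S b a)) (allWV D))

  -- γ-paths

  directVertices detourVertices : Fin n → Fin n → Fin n → List (WV D)
  directVertices v w x = star v ∷ root v w ∷ sec v w x ∷ star x ∷ []
  detourVertices v w x = star v ∷ root v w ∷ ysec v w x ∷ sec v w x ∷ star x ∷ []

  gammaPath-direct : T (NvMinusNw D v w x) → gammaPath D (v , w , x) ≡ pathArcs (directVertices v w x)
  gammaPath-direct {v} {w} {x} tx with NcvMinusNw D v w x | NvMinusNw⇒NcvMinusNw tx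
  ... | true | _ = refl

  gammaPath-detour : T (NwMinusNcv D v w x) → gammaPath D (v , w , x) ≡ pathArcs (detourVertices v w x)
  gammaPath-detour {v} {w} {x} tx with NcvMinusNw D v w x | NwMinusNcv⇒¬NcvMinusNw tx
  ... | true  | ¬direct = ⊥-elim (¬direct _)
  ... | false | _       = refl

  ∈gammaPath-direct : ∀ {e} → T (NvMinusNw D v w x) →
                      e ∈ pathArcs (directVertices v w x) → e ∈ gammaPath D (v , w , x)
  ∈gammaPath-direct tx = subst (_ ∈_) (sym (gammaPath-direct tx))

  ∈gammaPath-detour : ∀ {e} → T (NwMinusNcv D v w x) →
                      e ∈ pathArcs (detourVertices v w x) → e ∈ gammaPath D (v , w , x)
  ∈gammaPath-detour tn = subst (_ ∈_) (sym (gammaPath-detour tn))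

  gammaPath-first : ∀ v w x → (star v , root v w) ∈ gammaPath D (v , w , x)
  gammaPath-first v w x with NcvMinusNw D v w x
  ... | true  = here refl
  ... | false = here refl

  gammaPath-sector : ∀ {e} → e ∈ gammaPath D (v , w , x) → arcSector e ≡ just (v , w)
  gammaPath-sector {v} {w} {x} e∈ with NcvMinusNw D v w x | e∈
  ... | true  | here refl                       = refl
  ... | true  | there (here refl)               = refl
  ... | true  | there (there (here refl))       = refl
  ... | false | here refl                       = refl
  ... | false | there (here refl)               = refl
  ... | false | there (there (here refl))       = refl
  ... | false | there (there (there (here refl))) = refl

  gammaPath-succ-exists : sector a ≡ just vw → (b , a) ∈ gammaPath D (v , w , x) →
                          ∃ λ c → (a , c) ∈ gammaPath D (v , w , x)
  gammaPath-succ-exists {v = v} {w} {x} sa m with NcvMinusNw D v w x | m | sa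
  ... | true  | here refl                 | _  = _ , there (here refl)
  ... | true  | there (here refl)         | _  = _ , there (there (here refl))
  ... | true  | there (there (here refl)) | ()
  ... | false | here refl                         | _  = _ , there (here refl)
  ... | false | there (here refl)                 | _  = _ , there (there (here refl))
  ... | false | there (there (here refl))         | _  = _ , there (there (there (here refl)))
  ... | false | there (there (there (here refl))) | ()

  gammaPath-pred-exists : sector a ≡ just vw → (a , c) ∈ gammaPath D (v , w , x) →
                          ∃ λ b → (b , a) ∈ gammaPath D (v , w , x)
  gammaPath-pred-exists {v = v} {w} {x} sa m with NcvMinusNw D v w x | m | sa
  ... | true  | here refl                 | ()
  ... | true  | there (here refl)         | _  = _ , here refl
  ... | true  | there (there (here refl)) | _  = _ , there (here refl)
  ... | false | here refl                         | ()
  ... | false | there (here refl)                 | _  = _ , here refl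
  ... | false | there (there (here refl))         | _  = _ , there (here refl)
  ... | false | there (there (there (here refl))) | _  = _ , there (there (here refl))

  gammaPath-simple : IsGammaIndex D (v , w , x) →
                     ∃ λ vs → Unique vs × gammaPath D (v , w , x) ≡ pathArcs vs
  gammaPath-simple {v} {w} {x} γ with NcvMinusNw D v w x
  ... | true  = directVertices v w x , direct-unique , refl
    where
    direct-unique : Unique (directVertices v w x)
    direct-unique = ((λ ()) ∷ (λ ()) ∷ (λ { refl → γ⇒≢ γ refl }) ∷ [])
                  ∷ ((λ { refl → γ⇒≢ γ refl }) ∷ (λ ()) ∷ [])
                  ∷ ((λ ()) ∷ []) ∷ [] ∷ []
  ... | false = detourVertices v w x , detour-unique , refl
    where
    detour-unique : Unique (detourVertices v w x)
    detour-unique = ((λ ()) ∷ (λ ()) ∷ (λ ()) ∷ (λ { refl → γ⇒≢ γ refl }) ∷ [])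
                  ∷ ((λ ()) ∷ (λ { refl → γ⇒≢ γ refl }) ∷ (λ ()) ∷ [])
                  ∷ ((λ ()) ∷ (λ ()) ∷ []) ∷ ((λ ()) ∷ []) ∷ [] ∷ []

  gammaPath-succ-unique : IsGammaIndex D (v , w , x) →
    (a , b) ∈ gammaPath D (v , w , x) → (a , c) ∈ gammaPath D (v , w , x) → b ≡ c
  gammaPath-succ-unique γ m m′ with gammaPath-simple γ
  ... | _ , simple , vs = pathArcs-succ-unique simple (subst (_ ∈_) vs m) (subst (_ ∈_) vs m′)

  gammaPath-pred-unique : IsGammaIndex D (v , w , x) →
    (a , c) ∈ gammaPath D (v , w , x) → (b , c) ∈ gammaPath D (v , w , x) → a ≡ b
  gammaPath-pred-unique γ m m′ with gammaPath-simple γ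
  ... | _ , simple , vs = pathArcs-pred-unique simple (subst (_ ∈_) vs m) (subst (_ ∈_) vs m′)

  -- An Eulerian S is a union of arc-disjoint γ-paths

  module Forward (S : SpanningSub D) (eulerian : Eulerian D S) where

    arcOf : T (sarc S a b) → WArc a b
    arcOf {a} {b} t = warc⇒WArc a b (sarc⊆ S a b t)

    balance : T (isVertex D a) → count (sarc S a) (allWV D) ≡ count (λ b → sarc S b a) (allWV D)
    balance {a} isV = begin
      count (sarc S a) (allWV D)          ≡⟨ outdeg-count S a ⟨
      outdeg D S a                        ≡⟨ eulerian a isV ⟩
      indeg D S a                         ≡⟨ indeg-count S a ⟩
      count (λ b → sarc S b a) (allWV D)  ∎
      where open ≡-Reasoning

    out⇒in : T (sarc S a b) → ∃ λ c → T (sarc S c a)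
    out⇒in {a} {b} t = count-pos⇒∃ (λ c → sarc S c a) (allWV D)
      (subst (1 ≤_) (balance (WArc-source-isVertex (arcOf t)))
             (count-pos (sarc S a) (allWV-complete b) t))

    in⇒out : T (sarc S b a) → ∃ λ c → T (sarc S a c)
    in⇒out {b} {a} t = count-pos⇒∃ (sarc S a) (allWV D)
      (subst (1 ≤_) (sym (balance (WArc-target-isVertex (arcOf t))))
             (count-pos (λ c → sarc S c a) (allWV-complete b) t))

    root-succ-unique : AtMostOne (sarc S (root v w))
    root-succ-unique {v} {w} {b} {b′} t t′ =
      count≤1⇒≡ (sarc S (root v w)) outdeg≤1 (allWV-complete b) (allWV-complete b′) t t′
      where
      indeg≤1 : count (λ c → sarc S c (root v w)) (allWV D) ≤ 1
      indeg≤1 = count≤1 _ allWV-unique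
        λ s s′ → trans (WArc-into-root (arcOf s)) (sym (WArc-into-root (arcOf s′)))

      outdeg≤1 : count (sarc S (root v w)) (allWV D) ≤ 1
      outdeg≤1 = subst (_≤ 1) (sym (balance (WArc-source-isVertex (arcOf t)))) indeg≤1

    UsedBranch : Fin n × Fin n × Fin n → Set
    UsedBranch (v , w , x) = T (sarc S (root v w) (sec v w x)) ⊎ T (sarc S (root v w) (ysec v w x))

    usedBranch? : Decidable UsedBranch
    usedBranch? (v , w , x) = T? _ ⊎-dec T? _

    UsedBranch⇒rootArc : UsedBranch (v , w , x) → ∃ λ b → T (sarc S (root v w) b) × copyOf b ≡ x
    UsedBranch⇒rootArc (inj₁ t) = _ , t , refl
    UsedBranch⇒rootArc (inj₂ t) = _ , t , refl

    usedBranch-unique : UsedBranch (v , w , x) → UsedBranch (v , w , x′) → x ≡ x′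
    usedBranch-unique c c′ with UsedBranch⇒rootArc c | UsedBranch⇒rootArc c′
    ... | _ , t , refl | _ , t′ , refl = cong copyOf (root-succ-unique t t′)

    usedBranch⇒γ : UsedBranch (v , w , x) → IsGammaIndex D (v , w , x)
    usedBranch⇒γ (inj₁ t) with arcOf t
    ... | direct ta tx = ta , NvMinusNw⇒γ tx
    usedBranch⇒γ (inj₂ t) with arcOf t
    ... | detour ta tn = ta , NwMinusNcv⇒γ tn

    entry∈S : T (sarc S (root v w) c) → T (sarc S (star v) (root v w))
    entry∈S t with out⇒in t
    ... | _ , t′ with WArc-into-root (arcOf t′)
    ...   | refl = t′

    rejoin∈S : T (sarc S c (ysec v w x)) → T (sarc S (ysec v w x) (sec v w x))
    rejoin∈S t with in⇒out t
    ... | _ , t′ with WArc-from-ysec (arcOf t′)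
    ...   | refl = t′

    exit∈S : x ≢ v → T (sarc S c (sec v w x)) → T (sarc S (sec v w x) (star x))
    exit∈S x≢v t with in⇒out t
    ... | _ , t′ with WArc-from-sec x≢v (arcOf t′)
    ...   | refl = t′

    usedBranch⇒gammaPath⊆S : UsedBranch (v , w , x) → (a , b) ∈ gammaPath D (v , w , x) →
                             T (sarc S a b)
    usedBranch⇒gammaPath⊆S (inj₁ t) m with arcOf t
    ... | direct _ tx with subst (_ ∈_) (gammaPath-direct tx) m
    ...   | here refl                 = entry∈S t
    ...   | there (here refl)         = t
    ...   | there (there (here refl)) = exit∈S (NvMinusNw⇒≢ tx) t
    usedBranch⇒gammaPath⊆S (inj₂ t) m with arcOf t
    ... | detour _ tn with subst (_ ∈_) (gammaPath-detour tn) m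
    ...   | here refl                         = entry∈S t
    ...   | there (here refl)                 = t
    ...   | there (there (here refl))         = rejoin∈S t
    ...   | there (there (there (here refl))) = exit∈S (NwMinusNcv⇒≢ tn) (rejoin∈S t)

    S⊆usedPaths : T (sarc S a b) → ∃ λ p → UsedBranch p × (a , b) ∈ gammaPath D p
    S⊆usedPaths t with arcOf t
    ... | enter _ with in⇒out t
    ...   | _ , t′ with arcOf t′
    ...     | direct _ _     = _ , inj₁ t′ , gammaPath-first _ _ _
    ...     | detour _ _     = _ , inj₂ t′ , gammaPath-first _ _ _
    ...     | leave _ _ x≢v  = ⊥-elim (x≢v refl)
    S⊆usedPaths t | direct _ tx = _ , inj₁ t , ∈gammaPath-direct tx (there (here refl))
    S⊆usedPaths t | detour _ tn = _ , inj₂ t , ∈gammaPath-detour tn (there (here refl))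
    S⊆usedPaths t | rejoin _ tn with out⇒in t
    ... | _ , t′ with WArc-into-ysec (arcOf t′)
    ...   | refl = _ , inj₂ t′ , ∈gammaPath-detour tn (there (there (here refl)))
    S⊆usedPaths t | leave _ _ x≢v with out⇒in t
    ... | _ , t′ with arcOf t′
    ...   | direct _ tx = _ , inj₁ t′ , ∈gammaPath-direct tx (there (there (here refl)))
    ...   | enter _     = ⊥-elim (x≢v refl)
    ...   | rejoin _ tn with out⇒in t′
    ...     | _ , t″ with WArc-into-ysec (arcOf t″)
    ...       | refl = _ , inj₂ t″ , ∈gammaPath-detour tn (there (there (there (here refl))))

    usedPaths : List (Fin n × Fin n × Fin n)
    usedPaths = filter usedBranch? allTriples

    usedPaths-disjoint : AllPairs (λ p q → ArcDisjoint D (gammaPath D p) (gammaPath D q)) usedPaths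
    usedPaths-disjoint = Unique⇒AllPairs (Unique.filter⁺ usedBranch? allTriples-unique)
      (All.tabulate (proj₂ ∘ ∈-filter⁻ usedBranch? {xs = allTriples})) disjoint
      where
      disjoint : ∀ {p q} → UsedBranch p → UsedBranch q → p ≢ q →
                 ArcDisjoint D (gammaPath D p) (gammaPath D q)
      disjoint {v , w , x} {v′ , w′ , x′} cp cq p≢q e ep eq
        with trans (sym (gammaPath-sector ep)) (gammaPath-sector eq)
      ... | refl = p≢q (cong (λ x → v , w , x) (usedBranch-unique cp cq))

    union : UnionOfDisjointGammaPaths D S
    union = usedPaths
          , All.tabulate (usedBranch⇒γ ∘ proj₂ ∘ ∈-filter⁻ usedBranch? {xs = allTriples})
          , usedPaths-disjoint
          , λ a b → mk⇔ S⇒paths paths⇒S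
      where
      S⇒paths : T (sarc S a b) → Any (λ p → (a , b) ∈ gammaPath D p) usedPaths
      S⇒paths t with S⊆usedPaths t
      ... | p , cp , m = lose (∈-filter⁺ usedBranch? (allTriples-complete p) cp) m

      paths⇒S : Any (λ p → (a , b) ∈ gammaPath D p) usedPaths → T (sarc S a b)
      paths⇒S any with find any
      ... | p , p∈ , m = usedBranch⇒gammaPath⊆S (proj₂ (∈-filter⁻ usedBranch? {xs = allTriples} p∈)) m

    starsBalanced : StarsBalanced D S
    starsBalanced v = eulerian (star v) _

  -- A union of arc-disjoint γ-paths is balanced off the stars

  module Backward
    (S : SpanningSub D) (paths : List (Fin n × Fin n × Fin n))
    (γ : All (IsGammaIndex D) paths)
    (disjoint : AllPairs (λ p q → ArcDisjoint D (gammaPath D p) (gammaPath D q)) paths)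
    (S⇔paths : ∀ a b → T (sarc S a b) ⇔ Any (λ p → (a , b) ∈ gammaPath D p) paths)
    (starsBalanced : StarsBalanced D S)
    where

    S⇒path : T (sarc S a b) → ∃ λ p → p ∈ paths × (a , b) ∈ gammaPath D p
    S⇒path {a} {b} = find ∘ Equivalence.to (S⇔paths a b)

    path⇒S : ∀ {p} → p ∈ paths → (a , b) ∈ gammaPath D p → T (sarc S a b)
    path⇒S {a} {b} p∈ m = Equivalence.from (S⇔paths a b) (lose p∈ m)

    sectorPath-unique : (v , w , x) ∈ paths → (v , w , x′) ∈ paths → x ≡ x′
    sectorPath-unique m m′ = cong (proj₂ ∘ proj₂)
      (pairwiseDisjoint-shared⇒≡ (gammaPath D) disjoint m m′ (gammaPath-first _ _ _) (gammaPath-first _ _ _))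

    outArc-sectorPath : sector a ≡ just (v , w) → T (sarc S a b) →
                        ∃ λ x → (v , w , x) ∈ paths × (a , b) ∈ gammaPath D (v , w , x)
    outArc-sectorPath sa t with S⇒path t
    ... | (_ , _ , x) , p∈ , m with trans (sym (arcSector-source sa)) (gammaPath-sector m)
    ...   | refl = x , p∈ , m

    inArc-sectorPath : sector a ≡ just (v , w) → T (sarc S b a) →
                       ∃ λ x → (v , w , x) ∈ paths × (b , a) ∈ gammaPath D (v , w , x)
    inArc-sectorPath sa t with S⇒path t
    ... | (_ , _ , x) , p∈ , m with gammaPath-succ-exists sa m
    ...   | _ , m′ with trans (sym (arcSector-source sa)) (gammaPath-sector m′)
    ...     | refl = x , p∈ , m

    succ-unique : sector a ≡ just (v , w) → AtMostOne (sarc S a)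
    succ-unique sa t t′ with outArc-sectorPath sa t | outArc-sectorPath sa t′
    ... | _ , p∈ , m | _ , p∈′ , m′ with sectorPath-unique p∈ p∈′
    ...   | refl = gammaPath-succ-unique (All.lookup γ p∈) m m′

    pred-unique : sector a ≡ just (v , w) → AtMostOne (λ b → sarc S b a)
    pred-unique sa t t′ with inArc-sectorPath sa t | inArc-sectorPath sa t′
    ... | _ , p∈ , m | _ , p∈′ , m′ with sectorPath-unique p∈ p∈′
    ...   | refl = gammaPath-pred-unique (All.lookup γ p∈) m m′

    out⇒in : sector a ≡ just vw → ∃ (λ b → T (sarc S a b)) → ∃ (λ c → T (sarc S c a))
    out⇒in sa (_ , t) with S⇒path t
    ... | _ , p∈ , m with gammaPath-pred-exists sa m
    ...   | c , m′ = c , path⇒S p∈ m′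

    in⇒out : sector a ≡ just vw → ∃ (λ b → T (sarc S b a)) → ∃ (λ c → T (sarc S a c))
    in⇒out sa (_ , t) with S⇒path t
    ... | _ , p∈ , m with gammaPath-succ-exists sa m
    ...   | c , m′ = c , path⇒S p∈ m′

    balanced-off-stars : sector a ≡ just (v , w) → outdeg D S a ≡ indeg D S a
    balanced-off-stars {a} sa = begin
      outdeg D S a                        ≡⟨ outdeg-count S a ⟩
      count (sarc S a) (allWV D)          ≡⟨ count-cong _ _ allWV-unique allWV-complete
                                               (succ-unique sa) (pred-unique sa) (out⇒in sa) (in⇒out sa) ⟩
      count (λ b → sarc S b a) (allWV D)  ≡⟨ indeg-count S a ⟨
      indeg D S a                         ∎
      where open ≡-Reasoning

    eulerian : Eulerian D S
    eulerian (star x)     _ = starsBalanced x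
    eulerian (sec v w x)  _ = balanced-off-stars refl
    eulerian (ysec v w x) _ = balanced-off-stars refl

mainTheorem3 : (n : ℕ) (D : SimpleDigraph n) (S : SpanningSub D) →
    Eulerian D S ⇔ (UnionOfDisjointGammaPaths D S × StarsBalanced D S)
mainTheorem3 n D S = mk⇔
  (λ eulerian → Forward.union D S eulerian , Forward.starsBalanced D S eulerian)
  (λ ((paths , γ , disjoint , S⇔paths) , starsBalanced) →
     Backward.eulerian D S paths γ disjoint S⇔paths starsBalanced)
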